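{- For every sufficiently large integer $n$ with $n \equiv 1 \text{ or } 3 \pmod 6$, there is an $n$-vertex $3$-uniform hypergraph $H$ with minimum codegree at least $\frac{3}{4}n - 10$ which contains no Steiner triple system.
   Context: For a $3$-uniform hypergraph $H$, the codegree of a pair of distinct vertices is the number of edges of $H$ containing that pair, and the minimum codegree is the minimum over all pairs of distinct vertices. A Steiner triple system in $H$ is a set $S \subseteq E(H)$ such that every pair of distinct vertices of $V(H)$ is contained in exactly one member of $S$. -}

module Defs where

open import Data.Nat using (ℕ; _≡ᵇ_)
open import Data.Bool using (Bool; true; false; _∧_)
open import Data.Fin using (Fin)
open import Data.Fin.Subset using (Subset; ∣_∣; _∈_)
open import Data.Fin.Subset.Properties using (_∈?_)
open import Data.List using (List; filter; length)
open import Data.List.Relation.Unary.All using (All)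
open import Data.List.Relation.Unary.Unique.Propositional using (Unique)
open import Data.List.Membership.Propositional renaming (_∈_ to _∈ˡ_)
open import Data.Product using (_×_; ∃)
open import Relation.Binary.PropositionalEquality using (_≡_)
open import Relation.Nullary using (¬_)
open import Relation.Nullary.Decidable using (_×-dec_)

record Hypergraph3 (n : ℕ) : Set where
  field
    edges   : List (Subset n)
    unique  : Unique edges
    uniform : All (λ e → ∣ e ∣ ≡ 3) edges
open Hypergraph3 public

pairCount : {n : ℕ} → List (Subset n) → Fin n → Fin n → ℕ
pairCount es x y = length (filter (λ e → (x ∈? e) ×-dec (y ∈? e)) es)

codegree : {n : ℕ} → Hypergraph3 n → Fin n → Fin n → ℕ
codegree H x y = pairCount (edges H) x y

IsSTSIn : {n : ℕ} → Hypergraph3 n → List (Subset n) → Set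
IsSTSIn {n} H S =
  Unique S × All (λ e → e ∈ˡ edges H) S ×
  ((x y : Fin n) → ¬ (x ≡ y) → pairCount S x y ≡ 1)

ContainsSTS : {n : ℕ} → Hypergraph3 n → Set
ContainsSTS H = ∃ (IsSTSIn H)

-- Label the vertices by the Klein four-group ℤ₂² = {𝟘, α, β, γ} and give an ordered pair of
-- distinct vertices with labels p, q the weight w(p,q) = [p = 𝟘] + [p, q, 𝟘 pairwise distinct].
-- Let H consist of the triples whose six ordered pairs have total weight divisible by 4.
-- Every triple whose labels do not sum to 𝟘 is an edge, so the codegree of x, y is at least
-- n − 2 minus the number of vertices labelled lab x ⊕ lab y, about 3n/4 when the label classes
-- have sizes a, b, b, b with a ≈ b. A Steiner triple system covers every pair once, so the
-- weights of its blocks add up to the weight a(n − 1) + 6b² of all ordered pairs; for a even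
-- and b odd this is 2 mod 4, while each block weight is 0 mod 4.

module Submission where

open import Defs
open import Data.Nat as ℕ using (ℕ; zero; suc; _≤_; _<_; _+_; _*_; _%_; _/_; z≤n; s≤s)
open import Data.Nat.Properties hiding (_≟_)
open import Data.Nat.DivMod using (m≡m%n+[m/n]*n; m%n<n; m∣n⇒o%n%m≡o%m)
open import Data.Nat.Divisibility using (_∣_; _∣?_; _∣0; ∣m∣n⇒∣m+n; ∣m+n∣m⇒∣n; m∣m*n; ∣⇒≤; divides)
open import Data.Nat.Tactic.RingSolver using (solve-∀)
open import Data.Bool using (Bool; true; false; if_then_else_; _xor_)
import Data.Bool.Properties as Bool
open import Data.Fin using (Fin; zero; suc)
open import Data.Fin.Properties using (_≟_)
open import Data.Fin.Subset using (Subset; inside; outside; _∈_; ∣_∣; ⁅_⁆; _∪_)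
open import Data.Fin.Subset.Properties using (_∈?_; x∈⁅x⁆; x∈⁅y⁆⇒x≡y; x∈p∪q⁺; x∈p∪q⁻)
open import Data.List using (List; []; _∷_; _++_; length; filter; map; tabulate; allFin)
open import Data.List.Properties using (length-++)
open import Data.List.Membership.Propositional using () renaming (_∈_ to _∈ˡ_)
open import Data.List.Membership.Propositional.Properties
  using (∈-∃++; ∈-++⁻; ∈-++⁺ˡ; ∈-++⁺ʳ; ∈-map⁺; ∈-map⁻; ∈-filter⁺; ∈-filter⁻)
open import Data.List.Relation.Unary.All as All using (All; []; _∷_; all?)
open import Data.List.Relation.Unary.AllPairs using ([]; _∷_)
open import Data.List.Relation.Unary.Any using (here; there)
open import Data.List.Relation.Unary.Unique.Propositional using (Unique)
import Data.List.Relation.Unary.Unique.Propositional.Properties as Unique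
open import Data.Vec using (Vec; []; _∷_; lookup; replicate) renaming (_++_ to _++ᵛ_)
open import Data.Vec.Properties using (∷-injectiveʳ)
open import Data.Product using (∃; _×_; _,_; proj₁; proj₂)
open import Data.Product.Properties using (≡-dec)
open import Data.Sum using (_⊎_; inj₁; inj₂; [_,_]; [_,_]′)
open import Data.Empty using (⊥-elim)
open import Function using (_∘_; id)
open import Relation.Binary.Definitions using (DecidableEquality)
open import Relation.Binary.PropositionalEquality
  using (_≡_; _≢_; refl; sym; trans; cong; cong₂; subst; module ≡-Reasoning)
open import Relation.Nullary using (¬_; Dec; does; yes; no; ¬?)
open import Relation.Nullary.Decidable using (dec-true; dec-false; from-yes; _×-dec_; _⊎-dec_)
open import Relation.Unary using (Decidable)
open import Algebra.Properties.Semiring.Sum +-*-semiring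
  using (sum-syntax; sum-cong-≋; sum-replicate-zero; ∑-distrib-+; *-distribˡ-sum)

𝟙 : ∀ {p} {P : Set p} → Dec P → ℕ
𝟙 d = if does d then 1 else 0

𝟙-¬?+𝟙 : ∀ {p} {P : Set p} (d : Dec P) → 𝟙 (¬? d) + 𝟙 d ≡ 1
𝟙-¬?+𝟙 (yes _) = refl
𝟙-¬?+𝟙 (no _)  = refl

𝟙-true : ∀ {p} {P : Set p} (d : Dec P) → P → 𝟙 d ≡ 1
𝟙-true d p rewrite dec-true d p = refl

𝟙-false : ∀ {p} {P : Set p} (d : Dec P) → ¬ P → 𝟙 d ≡ 0
𝟙-false d ¬p rewrite dec-false d ¬p = refl

∑-mono-≤ : ∀ {n} {f g : Fin n → ℕ} → (∀ i → f i ≤ g i) → ∑[ i < n ] f i ≤ ∑[ i < n ] g i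
∑-mono-≤ {zero}  f≤g = z≤n
∑-mono-≤ {suc n} f≤g = +-mono-≤ (f≤g zero) (∑-mono-≤ (f≤g ∘ suc))

∑-1 : ∀ n → ∑[ i < n ] 1 ≡ n
∑-1 zero    = refl
∑-1 (suc n) = cong suc (∑-1 n)

∑-select : ∀ {n} (x : Fin n) (g : Fin n → ℕ) → ∑[ u < n ] (𝟙 (x ≟ u) * g u) ≡ g x
∑-select {suc n} zero g = begin
  1 * g zero + ∑[ u < n ] 0 ≡⟨ cong₂ _+_ (*-identityˡ (g zero)) (sum-replicate-zero n) ⟩
  g zero + 0                ≡⟨ +-identityʳ (g zero) ⟩
  g zero                    ∎
  where open ≡-Reasoning
∑-select {suc n} (suc x) g = ∑-select x (g ∘ suc)

∑-𝟙-≟ : ∀ {n} (x : Fin n) → ∑[ u < n ] 𝟙 (x ≟ u) ≡ 1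
∑-𝟙-≟ {n} x = trans (sum-cong-≋ {n} (λ u → sym (*-identityʳ (𝟙 (x ≟ u))))) (∑-select x (λ _ → 1))

∑-offDiagonal : ∀ {n} (x : Fin n) (g : Fin n → ℕ) →
  ∑[ u < n ] (𝟙 (¬? (x ≟ u)) * g u) + g x ≡ ∑[ u < n ] g u
∑-offDiagonal {n} x g = begin
  ∑[ u < n ] off u + g x                  ≡⟨ cong (∑[ u < n ] off u +_) (∑-select x g) ⟨
  ∑[ u < n ] off u + ∑[ u < n ] diag u    ≡⟨ ∑-distrib-+ off diag ⟨
  ∑[ u < n ] (off u + diag u)             ≡⟨ sum-cong-≋ split ⟨
  ∑[ u < n ] g u                          ∎
  where
  open ≡-Reasoning
  off diag : Fin n → ℕ
  off  u = 𝟙 (¬? (x ≟ u)) * g u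
  diag u = 𝟙 (x ≟ u) * g u
  split : ∀ u → g u ≡ off u + diag u
  split u = begin
    g u                                   ≡⟨ *-identityˡ (g u) ⟨
    1 * g u                               ≡⟨ cong (_* g u) (𝟙-¬?+𝟙 (x ≟ u)) ⟨
    (𝟙 (¬? (x ≟ u)) + 𝟙 (x ≟ u)) * g u    ≡⟨ *-distribʳ-+ (g u) (𝟙 (¬? (x ≟ u))) _ ⟩
    off u + diag u                        ∎

1≤𝟙-none+𝟙+𝟙+𝟙 : ∀ {a b c} {A : Set a} {B : Set b} {C : Set c} (a? : Dec A) (b? : Dec B) (c? : Dec C) →
  1 ≤ 𝟙 (¬? a? ×-dec ¬? b? ×-dec ¬? c?) + 𝟙 a? + 𝟙 b? + 𝟙 c?
1≤𝟙-none+𝟙+𝟙+𝟙 (yes _) _       _       = s≤s z≤n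
1≤𝟙-none+𝟙+𝟙+𝟙 (no _)  (yes _) _       = s≤s z≤n
1≤𝟙-none+𝟙+𝟙+𝟙 (no _)  (no _)  (yes _) = s≤s z≤n
1≤𝟙-none+𝟙+𝟙+𝟙 (no _)  (no _)  (no _)  = s≤s z≤n

length-filter-tabulate : ∀ {a p} {A : Set a} {P : A → Set p} (P? : Decidable P) {n} (f : Fin n → A) →
  length (filter P? (tabulate f)) ≡ ∑[ i < n ] 𝟙 (P? (f i))
length-filter-tabulate P? {zero}  f = refl
length-filter-tabulate P? {suc n} f with does (P? (f zero))
... | true  = cong suc (length-filter-tabulate P? (f ∘ suc))
... | false = length-filter-tabulate P? (f ∘ suc)

length-≤-injection : ∀ {a b} {A : Set a} {B : Set b} (f : A → B) {xs : List A} {ys : List B} →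
  Unique xs → (∀ {a a′} → a ∈ˡ xs → a′ ∈ˡ xs → f a ≡ f a′ → a ≡ a′) →
  (∀ {a} → a ∈ˡ xs → f a ∈ˡ ys) → length xs ≤ length ys
length-≤-injection f {[]}     _                  _   _    = z≤n
length-≤-injection f {x ∷ xs} (x∉xs ∷ xs-unique) inj into
  with us , vs , refl ← ∈-∃++ (into (here refl)) = begin
    suc (length xs)                ≤⟨ s≤s (length-≤-injection f xs-unique (λ a a′ → inj (there a) (there a′)) into′) ⟩
    suc (length (us ++ vs))        ≡⟨ cong suc (length-++ us) ⟩
    suc (length us + length vs)    ≡⟨ +-suc (length us) (length vs) ⟨
    length us + length (f x ∷ vs)  ≡⟨ length-++ us ⟨
    length (us ++ f x ∷ vs)        ∎
  where
  open ≤-Reasoning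
  into′ : ∀ {a} → a ∈ˡ xs → f a ∈ˡ us ++ vs
  into′ a∈xs with ∈-++⁻ us (into (there a∈xs))
  ... | inj₁ fa∈us        = ∈-++⁺ˡ fa∈us
  ... | inj₂ (here fa≡fx) = ⊥-elim (All.lookup x∉xs a∈xs (sym (inj (there a∈xs) (here refl) fa≡fx)))
  ... | inj₂ (there fa∈vs) = ∈-++⁺ʳ us fa∈vs

allSubsets : ∀ n → List (Subset n)
allSubsets zero    = [] ∷ []
allSubsets (suc n) = map (outside ∷_) (allSubsets n) ++ map (inside ∷_) (allSubsets n)

∈-allSubsets : ∀ {n} (e : Subset n) → e ∈ˡ allSubsets n
∈-allSubsets []            = here refl
∈-allSubsets (outside ∷ e) = ∈-++⁺ˡ (∈-map⁺ (outside ∷_) (∈-allSubsets e))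
∈-allSubsets (inside ∷ e)  = ∈-++⁺ʳ _ (∈-map⁺ (inside ∷_) (∈-allSubsets e))

allSubsets-unique : ∀ n → Unique (allSubsets n)
allSubsets-unique zero    = [] ∷ []
allSubsets-unique (suc n) =
  Unique.++⁺ (Unique.map⁺ ∷-injectiveʳ (allSubsets-unique n)) (Unique.map⁺ ∷-injectiveʳ (allSubsets-unique n)) heads-differ
  where
  heads-differ : ∀ {e} → ¬ (e ∈ˡ map (outside ∷_) (allSubsets n) × e ∈ˡ map (inside ∷_) (allSubsets n))
  heads-differ (e∈outs , e∈ins) with ∈-map⁻ (outside ∷_) e∈outs | ∈-map⁻ (inside ∷_) e∈ins
  ... | _ , _ , refl | _ , _ , ()

∣p∣≡∑𝟙∈p : ∀ {n} (e : Subset n) → ∣ e ∣ ≡ ∑[ u < n ] 𝟙 (u ∈? e)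
∣p∣≡∑𝟙∈p []            = refl
∣p∣≡∑𝟙∈p (inside ∷ e)  = cong suc (∣p∣≡∑𝟙∈p e)
∣p∣≡∑𝟙∈p (outside ∷ e) = ∣p∣≡∑𝟙∈p e

triple : ∀ {n} → Fin n → Fin n → Fin n → Subset n
triple x y z = ⁅ x ⁆ ∪ ⁅ y ⁆ ∪ ⁅ z ⁆

module _ {n} {x y z : Fin n} where

  ∈-triple⁺ : ∀ {u} → x ≡ u ⊎ y ≡ u ⊎ z ≡ u → u ∈ triple x y z
  ∈-triple⁺ (inj₁ refl)        = x∈p∪q⁺ (inj₁ (x∈⁅x⁆ x))
  ∈-triple⁺ (inj₂ (inj₁ refl)) = x∈p∪q⁺ (inj₂ (x∈p∪q⁺ (inj₁ (x∈⁅x⁆ y))))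
  ∈-triple⁺ (inj₂ (inj₂ refl)) = x∈p∪q⁺ (inj₂ (x∈p∪q⁺ (inj₂ (x∈⁅x⁆ z))))

  ∈-triple⁻ : ∀ {u} → u ∈ triple x y z → x ≡ u ⊎ y ≡ u ⊎ z ≡ u
  ∈-triple⁻ u∈t with x∈p∪q⁻ ⁅ x ⁆ _ u∈t
  ... | inj₁ u∈x = inj₁ (sym (x∈⁅y⁆⇒x≡y x u∈x))
  ... | inj₂ u∈yz with x∈p∪q⁻ ⁅ y ⁆ ⁅ z ⁆ u∈yz
  ...   | inj₁ u∈y = inj₂ (inj₁ (sym (x∈⁅y⁆⇒x≡y y u∈y)))
  ...   | inj₂ u∈z = inj₂ (inj₂ (sym (x∈⁅y⁆⇒x≡y z u∈z)))

  module _ (x≢y : x ≢ y) (x≢z : x ≢ z) (y≢z : y ≢ z) where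

    𝟙-∈-triple : ∀ u → 𝟙 (u ∈? triple x y z) ≡ 𝟙 (x ≟ u) + 𝟙 (y ≟ u) + 𝟙 (z ≟ u)
    𝟙-∈-triple u with x ≟ u | y ≟ u | z ≟ u
    ... | yes refl | yes refl | _        = ⊥-elim (x≢y refl)
    ... | yes refl | no _     | yes refl = ⊥-elim (x≢z refl)
    ... | no _     | yes refl | yes refl = ⊥-elim (y≢z refl)
    ... | yes x≡u  | no _     | no _     = 𝟙-true (u ∈? _) (∈-triple⁺ (inj₁ x≡u))
    ... | no _     | yes y≡u  | no _     = 𝟙-true (u ∈? _) (∈-triple⁺ (inj₂ (inj₁ y≡u)))
    ... | no _     | no _     | yes z≡u  = 𝟙-true (u ∈? _) (∈-triple⁺ (inj₂ (inj₂ z≡u)))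
    ... | no x≢u   | no y≢u   | no z≢u   = 𝟙-false (u ∈? _) ([ x≢u , [ y≢u , z≢u ] ] ∘ ∈-triple⁻)

    ∑-triple : ∀ (g : Fin n → ℕ) → ∑[ u < n ] (𝟙 (u ∈? triple x y z) * g u) ≡ g x + g y + g z
    ∑-triple g = begin
      ∑[ u < n ] (𝟙 (u ∈? triple x y z) * g u)
        ≡⟨ sum-cong-≋ {n} (λ u → trans (cong (_* g u) (𝟙-∈-triple u)) (split u)) ⟩
      ∑[ u < n ] (at x u + at y u + at z u)
        ≡⟨ ∑-distrib-+ (λ u → at x u + at y u) (at z) ⟩
      ∑[ u < n ] (at x u + at y u) + ∑[ u < n ] at z u
        ≡⟨ cong (_+ ∑[ u < n ] at z u) (∑-distrib-+ (at x) (at y)) ⟩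
      ∑[ u < n ] at x u + ∑[ u < n ] at y u + ∑[ u < n ] at z u
        ≡⟨ cong₂ _+_ (cong₂ _+_ (∑-select x g) (∑-select y g)) (∑-select z g) ⟩
      g x + g y + g z ∎
      where
      open ≡-Reasoning
      at : Fin n → Fin n → ℕ
      at w u = 𝟙 (w ≟ u) * g u
      split : ∀ u → (𝟙 (x ≟ u) + 𝟙 (y ≟ u) + 𝟙 (z ≟ u)) * g u ≡ at x u + at y u + at z u
      split u = trans (*-distribʳ-+ (g u) (𝟙 (x ≟ u) + 𝟙 (y ≟ u)) _)
                      (cong (_+ at z u) (*-distribʳ-+ (g u) (𝟙 (x ≟ u)) _))

    ∣triple∣ : ∣ triple x y z ∣ ≡ 3
    ∣triple∣ = begin
      ∣ triple x y z ∣                               ≡⟨ ∣p∣≡∑𝟙∈p (triple x y z) ⟩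
      ∑[ u < n ] 𝟙 (u ∈? triple x y z)               ≡⟨ sum-cong-≋ {n} (λ u → *-identityʳ _) ⟨
      ∑[ u < n ] (𝟙 (u ∈? triple x y z) * 1)         ≡⟨ ∑-triple (λ _ → 1) ⟩
      3                                              ∎
      where open ≡-Reasoning

-- Double counting pair weights

pairCount-∷ : ∀ {n} (e : Subset n) (S : List (Subset n)) (u v : Fin n) →
  pairCount (e ∷ S) u v ≡ 𝟙 (u ∈? e) * 𝟙 (v ∈? e) + pairCount S u v
pairCount-∷ e S u v with does (u ∈? e) | does (v ∈? e)
... | true  | true  = refl
... | true  | false = refl
... | false | true  = refl
... | false | false = refl

module PairWeight {n : ℕ} (W : Fin n → Fin n → ℕ) where

  innerWeight : Subset n → ℕ
  innerWeight e = ∑[ u < n ] ∑[ v < n ] (𝟙 (u ∈? e) * 𝟙 (v ∈? e) * W u v)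

  coveredWeight : List (Subset n) → ℕ
  coveredWeight S = ∑[ u < n ] ∑[ v < n ] (pairCount S u v * W u v)

  totalWeight : ℕ
  totalWeight = ∑[ u < n ] ∑[ v < n ] W u v

  coveredWeight-[] : coveredWeight [] ≡ 0
  coveredWeight-[] = trans (sum-cong-≋ {n} (λ _ → sum-replicate-zero n)) (sum-replicate-zero n)

  coveredWeight-∷ : ∀ e S → coveredWeight (e ∷ S) ≡ innerWeight e + coveredWeight S
  coveredWeight-∷ e S = begin
    ∑[ u < n ] ∑[ v < n ] (pairCount (e ∷ S) u v * W u v)
      ≡⟨ sum-cong-≋ {n} (λ u → sum-cong-≋ {n} (λ v → cong (_* W u v) (pairCount-∷ e S u v))) ⟩
    ∑[ u < n ] ∑[ v < n ] ((𝟙 (u ∈? e) * 𝟙 (v ∈? e) + pairCount S u v) * W u v)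
      ≡⟨ sum-cong-≋ {n} (λ u → sum-cong-≋ {n} (λ v → *-distribʳ-+ (W u v) (𝟙 (u ∈? e) * 𝟙 (v ∈? e)) (pairCount S u v))) ⟩
    ∑[ u < n ] ∑[ v < n ] (inner u v + covered u v)
      ≡⟨ sum-cong-≋ {n} (λ u → ∑-distrib-+ (inner u) (covered u)) ⟩
    ∑[ u < n ] (∑[ v < n ] inner u v + ∑[ v < n ] covered u v)
      ≡⟨ ∑-distrib-+ (λ u → ∑[ v < n ] inner u v) (λ u → ∑[ v < n ] covered u v) ⟩
    innerWeight e + coveredWeight S ∎
    where
    open ≡-Reasoning
    inner covered : Fin n → Fin n → ℕ
    inner   u v = 𝟙 (u ∈? e) * 𝟙 (v ∈? e) * W u v
    covered u v = pairCount S u v * W u v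

  All∣⇒∣coveredWeight : ∀ {m} S → All (λ e → m ∣ innerWeight e) S → m ∣ coveredWeight S
  All∣⇒∣coveredWeight []       []         = subst (_ ∣_) (sym coveredWeight-[]) (_ ∣0)
  All∣⇒∣coveredWeight (e ∷ S) (m∣e ∷ m∣S) =
    subst (_ ∣_) (sym (coveredWeight-∷ e S)) (∣m∣n⇒∣m+n m∣e (All∣⇒∣coveredWeight S m∣S))

  -- The exact-cover hypothesis says nothing about pairCount S u u, so W must vanish on the diagonal.
  module _ (W-diagonal : ∀ u → W u u ≡ 0) where

    exactCover⇒coveredWeight≡totalWeight : ∀ S → (∀ x y → ¬ x ≡ y → pairCount S x y ≡ 1) → coveredWeight S ≡ totalWeight
    exactCover⇒coveredWeight≡totalWeight S covers = sum-cong-≋ {n} (λ u → sum-cong-≋ {n} (λ v → once u v))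
      where
      once : ∀ u v → pairCount S u v * W u v ≡ W u v
      once u v with u ≟ v
      ... | yes refl rewrite W-diagonal u = *-zeroʳ (pairCount S u u)
      ... | no u≢v   rewrite covers u v u≢v = *-identityˡ (W u v)

    ContainsSTS⇒∣totalWeight : ∀ {m} (H : Hypergraph3 n) → All (λ e → m ∣ innerWeight e) (edges H) →
      ContainsSTS H → m ∣ totalWeight
    ContainsSTS⇒∣totalWeight H m∣edges (S , _ , S⊆H , covers) =
      subst (_ ∣_) (exactCover⇒coveredWeight≡totalWeight S covers)
        (All∣⇒∣coveredWeight S (All.map (All.lookup m∣edges) S⊆H))

    innerWeight-triple : ∀ {x y z} → x ≢ y → x ≢ z → y ≢ z →
      innerWeight (triple x y z) ≡ W x y + W x z + W y x + W y z + W z x + W z y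
    innerWeight-triple {x} {y} {z} x≢y x≢z y≢z = begin
      ∑[ u < n ] ∑[ v < n ] (𝟙 (u ∈? t) * 𝟙 (v ∈? t) * W u v)
        ≡⟨ sum-cong-≋ {n} (λ u → trans (sum-cong-≋ {n} (λ v → *-assoc (𝟙 (u ∈? t)) _ _))
                                        (sym (*-distribˡ-sum (𝟙 (u ∈? t)) (λ v → 𝟙 (v ∈? t) * W u v)))) ⟩
      ∑[ u < n ] (𝟙 (u ∈? t) * ∑[ v < n ] (𝟙 (v ∈? t) * W u v))
        ≡⟨ sum-cong-≋ {n} (λ u → cong (𝟙 (u ∈? t) *_) (∑-triple x≢y x≢z y≢z (W u))) ⟩
      ∑[ u < n ] (𝟙 (u ∈? t) * row u)
        ≡⟨ ∑-triple x≢y x≢z y≢z row ⟩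
      row x + row y + row z
        ≡⟨ cong₂ _+_ (cong₂ _+_ (cong (λ w → w + W x y + W x z) (W-diagonal x))
                                (cong (λ w → W y x + w + W y z) (W-diagonal y)))
                     (cong (λ w → W z x + W z y + w) (W-diagonal z)) ⟩
      (0 + W x y + W x z) + (W y x + 0 + W y z) + (W z x + W z y + 0)
        ≡⟨ drop-zeros (W x y) (W x z) (W y x) (W y z) (W z x) (W z y) ⟩
      W x y + W x z + W y x + W y z + W z x + W z y ∎
      where
      open ≡-Reasoning
      t = triple x y z
      row : Fin n → ℕ
      row u = W u x + W u y + W u z
      drop-zeros : ∀ a b c d e f → (0 + a + b) + (c + 0 + d) + (e + f + 0) ≡ a + b + c + d + e + f
      drop-zeros = solve-∀

Label : Set
Label = Bool × Bool

𝟘 : Label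
𝟘 = false , false

infixl 6 _⊕_
infix 4 _≟ᴸ_

_⊕_ : Label → Label → Label
(a , b) ⊕ (c , d) = a xor c , b xor d

_≟ᴸ_ : DecidableEquality Label
_≟ᴸ_ = ≡-dec Bool._≟_ Bool._≟_

α β γ : Label
α = false , true
β = true  , false
γ = true  , true

labelWeight : Label → Label → ℕ
labelWeight p q = 𝟙 (p ≟ᴸ 𝟘) + 𝟙 (¬? (p ≟ᴸ 𝟘) ×-dec ¬? (q ≟ᴸ 𝟘) ×-dec ¬? (p ≟ᴸ q))

tripleWeight : Label → Label → Label → ℕ
tripleWeight p q r =
  labelWeight p q + labelWeight p r + labelWeight q p + labelWeight q r + labelWeight r p + labelWeight r q

allLabels : List Label
allLabels = 𝟘 ∷ α ∷ β ∷ γ ∷ []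

∈-allLabels : ∀ p → p ∈ˡ allLabels
∈-allLabels (false , false) = here refl
∈-allLabels (false , true)  = there (here refl)
∈-allLabels (true  , false) = there (there (here refl))
∈-allLabels (true  , true)  = there (there (there (here refl)))

4∣tripleWeight : ∀ p q r → r ≢ p ⊕ q → 4 ∣ tripleWeight p q r
4∣tripleWeight p q r r≢p⊕q =
  [ ⊥-elim ∘ r≢p⊕q , id ]′ (All.lookup (All.lookup (All.lookup table (∈-allLabels p)) (∈-allLabels q)) (∈-allLabels r))
  where
  table : All (λ p → All (λ q → All (λ r → r ≡ p ⊕ q ⊎ 4 ∣ tripleWeight p q r) allLabels) allLabels) allLabels
  table = from-yes (all? (λ p → all? (λ q → all? (λ r → (r ≟ᴸ p ⊕ q) ⊎-dec (4 ∣? tripleWeight p q r))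
                                                 allLabels) allLabels) allLabels)

module LabelledHypergraph {n : ℕ} (lab : Fin n → Label) where

  W : Fin n → Fin n → ℕ
  W u v = 𝟙 (¬? (u ≟ v)) * labelWeight (lab u) (lab v)

  W-diagonal : ∀ u → W u u ≡ 0
  W-diagonal u = cong (_* labelWeight (lab u) (lab u)) (𝟙-false (¬? (u ≟ u)) (λ u≢u → u≢u refl))

  W-offDiagonal : ∀ {u v} → u ≢ v → W u v ≡ labelWeight (lab u) (lab v)
  W-offDiagonal {u} {v} u≢v =
    trans (cong (_* labelWeight (lab u) (lab v)) (𝟙-true (¬? (u ≟ v)) u≢v)) (*-identityˡ _)

  open PairWeight W public

  IsEdge : Subset n → Set
  IsEdge e = ∣ e ∣ ≡ 3 × 4 ∣ innerWeight e

  isEdge? : Decidable IsEdge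
  isEdge? e = (∣ e ∣ ℕ.≟ 3) ×-dec (4 ∣? innerWeight e)

  H : Hypergraph3 n
  H = record
    { edges   = filter isEdge? (allSubsets n)
    ; unique  = Unique.filter⁺ isEdge? (allSubsets-unique n)
    ; uniform = All.tabulate (proj₁ ∘ proj₂ ∘ ∈-filter⁻ isEdge? {xs = allSubsets n})
    }

  ¬ContainsSTS : ¬ 4 ∣ totalWeight → ¬ ContainsSTS H
  ¬ContainsSTS 4∤total =
    4∤total ∘ ContainsSTS⇒∣totalWeight W-diagonal H (All.tabulate (proj₂ ∘ proj₂ ∘ ∈-filter⁻ isEdge? {xs = allSubsets n}))

  triple∈edges : ∀ {x y z} → x ≢ y → x ≢ z → y ≢ z → lab z ≢ lab x ⊕ lab y → triple x y z ∈ˡ edges H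
  triple∈edges {x} {y} {z} x≢y x≢z y≢z zero-sum-free =
    ∈-filter⁺ isEdge? (∈-allSubsets _) (∣triple∣ x≢y x≢z y≢z , subst (4 ∣_) (sym weight≡) (4∣tripleWeight (lab x) (lab y) (lab z) zero-sum-free))
    where
    weight≡ : innerWeight (triple x y z) ≡ tripleWeight (lab x) (lab y) (lab z)
    weight≡ rewrite innerWeight-triple W-diagonal x≢y x≢z y≢z
                  | W-offDiagonal x≢y | W-offDiagonal x≢z | W-offDiagonal (x≢y ∘ sym)
                  | W-offDiagonal y≢z | W-offDiagonal (x≢z ∘ sym) | W-offDiagonal (y≢z ∘ sym) = refl

  labelCount : Label → ℕ
  labelCount r = ∑[ z < n ] 𝟙 (lab z ≟ᴸ r)

  module _ {x y : Fin n} (x≢y : x ≢ y) where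

    Third : Fin n → Set
    Third z = x ≢ z × y ≢ z × lab z ≢ lab x ⊕ lab y

    third? : Decidable Third
    third? z = ¬? (x ≟ z) ×-dec ¬? (y ≟ z) ×-dec ¬? (lab z ≟ᴸ lab x ⊕ lab y)

    thirds : List (Fin n)
    thirds = filter third? (allFin n)

    n≤thirds+2+labelCount : n ≤ length thirds + 2 + labelCount (lab x ⊕ lab y)
    n≤thirds+2+labelCount = begin
      n                                                  ≡⟨ ∑-1 n ⟨
      ∑[ z < n ] 1                                       ≤⟨ ∑-mono-≤ (λ z → 1≤𝟙-none+𝟙+𝟙+𝟙 (x ≟ z) (y ≟ z) (lab z ≟ᴸ r)) ⟩
      ∑[ z < n ] (third z + at x z + at y z + labelled z) ≡⟨ ∑-distrib-+ _ labelled ⟩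
      ∑[ z < n ] (third z + at x z + at y z) + labelCount r
        ≡⟨ cong (_+ labelCount r) (trans (∑-distrib-+ _ (at y)) (cong (_+ ∑[ z < n ] at y z) (∑-distrib-+ third (at x)))) ⟩
      ∑[ z < n ] third z + ∑[ z < n ] at x z + ∑[ z < n ] at y z + labelCount r
        ≡⟨ cong₂ (λ s t → ∑[ z < n ] third z + s + t + labelCount r) (∑-𝟙-≟ x) (∑-𝟙-≟ y) ⟩
      ∑[ z < n ] third z + 1 + 1 + labelCount r          ≡⟨ cong (_+ labelCount r) (+-assoc _ 1 1) ⟩
      ∑[ z < n ] third z + 2 + labelCount r              ≡⟨ cong (λ s → s + 2 + labelCount r) (length-filter-tabulate third? id) ⟨
      length thirds + 2 + labelCount r                   ∎
      where
      open ≤-Reasoning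
      r = lab x ⊕ lab y
      third labelled : Fin n → ℕ
      third    z = 𝟙 (third? z)
      labelled z = 𝟙 (lab z ≟ᴸ r)
      at : Fin n → Fin n → ℕ
      at w z = 𝟙 (w ≟ z)

    thirds≤codegree : length thirds ≤ codegree H x y
    thirds≤codegree =
      length-≤-injection (triple x y) (Unique.filter⁺ third? (Unique.allFin⁺ n)) triple-injective triple-covers
      where
      third-of : ∀ {z} → z ∈ˡ thirds → Third z
      third-of = proj₂ ∘ ∈-filter⁻ third? {xs = allFin n}
      triple-injective : ∀ {a b} → a ∈ˡ thirds → b ∈ˡ thirds → triple x y a ≡ triple x y b → a ≡ b
      triple-injective a∈ _ eq with ∈-triple⁻ (subst (_ ∈_) eq (∈-triple⁺ (inj₂ (inj₂ refl))))
      ... | inj₁ x≡a        = ⊥-elim (proj₁ (third-of a∈) x≡a)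
      ... | inj₂ (inj₁ y≡a) = ⊥-elim (proj₁ (proj₂ (third-of a∈)) y≡a)
      ... | inj₂ (inj₂ b≡a) = sym b≡a
      triple-covers : ∀ {z} → z ∈ˡ thirds → triple x y z ∈ˡ filter (λ e → (x ∈? e) ×-dec (y ∈? e)) (edges H)
      triple-covers z∈ with third-of z∈
      ... | x≢z , y≢z , zero-sum-free =
        ∈-filter⁺ _ (triple∈edges x≢y x≢z y≢z zero-sum-free) (∈-triple⁺ (inj₁ refl) , ∈-triple⁺ (inj₂ (inj₁ refl)))

    codegree-lowerBound : n ≤ codegree H x y + 2 + labelCount (lab x ⊕ lab y)
    codegree-lowerBound =
      ≤-trans n≤thirds+2+labelCount (+-monoˡ-≤ (labelCount (lab x ⊕ lab y)) (+-monoˡ-≤ 2 thirds≤codegree))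

  totalWeight+diagonal : totalWeight + ∑[ u < n ] labelWeight (lab u) (lab u)
                       ≡ ∑[ u < n ] ∑[ v < n ] labelWeight (lab u) (lab v)
  totalWeight+diagonal =
    trans (sym (∑-distrib-+ (λ u → ∑[ v < n ] W u v) (λ u → labelWeight (lab u) (lab u))))
          (sum-cong-≋ {n} (λ u → ∑-offDiagonal u (λ v → labelWeight (lab u) (lab v))))

-- Block labellings

∑-lookup-++ : ∀ {a} {A : Set a} {m k} (g : A → ℕ) (xs : Vec A m) (ys : Vec A k) →
  ∑[ i < m + k ] g (lookup (xs ++ᵛ ys) i) ≡ ∑[ i < m ] g (lookup xs i) + ∑[ i < k ] g (lookup ys i)
∑-lookup-++ g []       ys = refl
∑-lookup-++ g (x ∷ xs) ys = trans (cong (g x +_) (∑-lookup-++ g xs ys)) (sym (+-assoc (g x) _ _))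

∑-lookup-replicate : ∀ {a} {A : Set a} (g : A → ℕ) k (x : A) → ∑[ i < k ] g (lookup (replicate k x) i) ≡ k * g x
∑-lookup-replicate g zero    x = refl
∑-lookup-replicate g (suc k) x = cong (g x +_) (∑-lookup-replicate g k x)

module Blocks (a b : ℕ) where

  size : ℕ
  size = a + (b + (b + b))

  lab : Fin size → Label
  lab = lookup (replicate a 𝟘 ++ᵛ replicate b α ++ᵛ replicate b β ++ᵛ replicate b γ)

  ∑-blocks : ∀ g → ∑[ v < size ] g (lab v) ≡ a * g 𝟘 + (b * g α + (b * g β + b * g γ))
  ∑-blocks g =
    trans (∑-lookup-++ g (replicate a 𝟘) _) (cong₂ _+_ (∑-lookup-replicate g a 𝟘)
    (trans (∑-lookup-++ g (replicate b α) _) (cong₂ _+_ (∑-lookup-replicate g b α)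
    (trans (∑-lookup-++ g (replicate b β) _) (cong₂ _+_ (∑-lookup-replicate g b β) (∑-lookup-replicate g b γ))))))

  open LabelledHypergraph lab public

  totalWeight-blocks : totalWeight + a ≡ a * size + 6 * (b * b)
  totalWeight-blocks = begin
    totalWeight + a
      ≡⟨ cong (totalWeight +_) (trans (∑-blocks (λ p → labelWeight p p)) (diagonal a b)) ⟨
    totalWeight + ∑[ u < size ] labelWeight (lab u) (lab u)
      ≡⟨ totalWeight+diagonal ⟩
    ∑[ u < size ] ∑[ v < size ] labelWeight (lab u) (lab v)
      ≡⟨ sum-cong-≋ {size} (λ u → ∑-blocks (labelWeight (lab u))) ⟩
    ∑[ u < size ] row (lab u)
      ≡⟨ ∑-blocks row ⟩
    _ ≡⟨ all-pairs a b ⟩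
    a * size + 6 * (b * b) ∎
    where
    open ≡-Reasoning
    row : Label → ℕ
    row p = a * labelWeight p 𝟘 + (b * labelWeight p α + (b * labelWeight p β + b * labelWeight p γ))
    diagonal : ∀ a b → a * 1 + (b * 0 + (b * 0 + b * 0)) ≡ a
    diagonal = solve-∀
    all-pairs : ∀ a b →
      a * (a * 1 + (b * 1 + (b * 1 + b * 1))) + (b * (a * 0 + (b * 0 + (b * 1 + b * 1)))
        + (b * (a * 0 + (b * 1 + (b * 0 + b * 1))) + b * (a * 0 + (b * 1 + (b * 1 + b * 0)))))
      ≡ a * (a + (b + (b + b))) + 6 * (b * b)
    all-pairs = solve-∀

  labelCount-blocks : ∀ r → labelCount r ≡ a ⊎ labelCount r ≡ b
  labelCount-blocks r = by-label r (∑-blocks (λ p → 𝟙 (p ≟ᴸ r)))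
    where
    only-𝟘 : ∀ a b → a * 1 + (b * 0 + (b * 0 + b * 0)) ≡ a
    only-𝟘 = solve-∀
    only-α : ∀ a b → a * 0 + (b * 1 + (b * 0 + b * 0)) ≡ b
    only-α = solve-∀
    only-β : ∀ a b → a * 0 + (b * 0 + (b * 1 + b * 0)) ≡ b
    only-β = solve-∀
    only-γ : ∀ a b → a * 0 + (b * 0 + (b * 0 + b * 1)) ≡ b
    only-γ = solve-∀
    by-label : ∀ r → labelCount r ≡ a * 𝟙 (𝟘 ≟ᴸ r) + (b * 𝟙 (α ≟ᴸ r) + (b * 𝟙 (β ≟ᴸ r) + b * 𝟙 (γ ≟ᴸ r))) →
               labelCount r ≡ a ⊎ labelCount r ≡ b
    by-label (false , false) eq = inj₁ (trans eq (only-𝟘 a b))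
    by-label (false , true)  eq = inj₂ (trans eq (only-α a b))
    by-label (true  , false) eq = inj₂ (trans eq (only-β a b))
    by-label (true  , true)  eq = inj₂ (trans eq (only-γ a b))

3n≤4c+40 : ∀ {n c k} → n ≤ c + 2 + k → 4 * k ≤ n + 32 → 3 * n ≤ 4 * c + 40
3n≤4c+40 {n} {c} {k} n≤c+2+k 4k≤n+32 = +-cancelʳ-≤ n (3 * n) (4 * c + 40) (begin
  3 * n + n             ≡⟨ quadruple n ⟩
  4 * n                 ≤⟨ *-monoʳ-≤ 4 n≤c+2+k ⟩
  4 * (c + 2 + k)       ≡⟨ *-distribˡ-+ 4 (c + 2) k ⟩
  4 * (c + 2) + 4 * k   ≤⟨ +-monoʳ-≤ (4 * (c + 2)) 4k≤n+32 ⟩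
  4 * (c + 2) + (n + 32) ≡⟨ regroup c n ⟩
  4 * c + 40 + n        ∎)
  where
  open ≤-Reasoning
  quadruple : ∀ n → 3 * n + n ≡ 4 * n
  quadruple = solve-∀
  regroup : ∀ c n → 4 * (c + 2) + (n + 32) ≡ 4 * c + 40 + n
  regroup = solve-∀

4∤4k+2 : ∀ k → ¬ 4 ∣ 4 * k + 2
4∤4k+2 k 4∣4k+2 with ∣⇒≤ (∣m+n∣m⇒∣n 4∣4k+2 (m∣m*n k))
... | s≤s (s≤s ())

DenseSTSFree : ℕ → Set
DenseSTSFree n = ∃ λ (H : Hypergraph3 n) →
  ((x y : Fin n) → x ≢ y → 3 * n ≤ 4 * codegree H x y + 40) × ¬ ContainsSTS H

module EvenOddBlocks (i j : ℕ) where

  open Blocks (2 * i) (1 + 2 * j) public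

  4∤totalWeight : ¬ 4 ∣ totalWeight
  4∤totalWeight 4∣total = 4∤4k+2 K (subst (4 ∣_) totalWeight≡4K+2 4∣total)
    where
    K : ℕ
    K = i * (i + 3 * j + 1) + 6 * j * (j + 1) + 1
    mod-4 : ∀ i j → 2 * i * (2 * i + ((1 + 2 * j) + ((1 + 2 * j) + (1 + 2 * j)))) + 6 * ((1 + 2 * j) * (1 + 2 * j))
                  ≡ 4 * (i * (i + 3 * j + 1) + 6 * j * (j + 1) + 1) + 2 + 2 * i
    mod-4 = solve-∀
    totalWeight≡4K+2 : totalWeight ≡ 4 * K + 2
    totalWeight≡4K+2 = +-cancelʳ-≡ (2 * i) totalWeight (4 * K + 2) (trans totalWeight-blocks (mod-4 i j))

  module _ (i≤2+j : i ≤ 2 + j) (j≤1+i : j ≤ 1 + i) where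

    balanced : ∀ r → 4 * labelCount r ≤ size + 32
    balanced r with labelCount-blocks r
    ... | inj₁ count≡a = begin
      4 * labelCount r          ≡⟨ cong (4 *_) count≡a ⟩
      4 * (2 * i)               ≡⟨ split-a i ⟩
      2 * i + 6 * i             ≤⟨ +-monoʳ-≤ (2 * i) (*-monoʳ-≤ 6 i≤2+j) ⟩
      2 * i + 6 * (2 + j)       ≤⟨ m≤m+n _ 23 ⟩
      2 * i + 6 * (2 + j) + 23  ≡⟨ size-a i j ⟩
      size + 32                 ∎
      where
      open ≤-Reasoning
      split-a : ∀ i → 4 * (2 * i) ≡ 2 * i + 6 * i
      split-a = solve-∀
      size-a : ∀ i j → 2 * i + 6 * (2 + j) + 23 ≡ 2 * i + ((1 + 2 * j) + ((1 + 2 * j) + (1 + 2 * j))) + 32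
      size-a = solve-∀
    ... | inj₂ count≡b = begin
      4 * labelCount r              ≡⟨ cong (4 *_) count≡b ⟩
      4 * (1 + 2 * j)               ≡⟨ split-b j ⟩
      4 + 6 * j + 2 * j             ≤⟨ +-monoʳ-≤ (4 + 6 * j) (*-monoʳ-≤ 2 j≤1+i) ⟩
      4 + 6 * j + 2 * (1 + i)       ≤⟨ m≤m+n _ 29 ⟩
      4 + 6 * j + 2 * (1 + i) + 29  ≡⟨ size-b i j ⟩
      size + 32                     ∎
      where
      open ≤-Reasoning
      split-b : ∀ j → 4 * (1 + 2 * j) ≡ 4 + 6 * j + 2 * j
      split-b = solve-∀
      size-b : ∀ i j → 4 + 6 * j + 2 * (1 + i) + 29 ≡ 2 * i + ((1 + 2 * j) + ((1 + 2 * j) + (1 + 2 * j))) + 32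
      size-b = solve-∀

    denseSTSFree : DenseSTSFree size
    denseSTSFree = H , dense , ¬ContainsSTS 4∤totalWeight
      where
      dense : ∀ x y → x ≢ y → 3 * size ≤ 4 * codegree H x y + 40
      dense x y x≢y = 3n≤4c+40 {k = labelCount (lab x ⊕ lab y)} (codegree-lowerBound x≢y) (balanced (lab x ⊕ lab y))

BalancedBlocks : ℕ → Set
BalancedBlocks n = ∃ λ i → ∃ λ j → i ≤ 2 + j × j ≤ 1 + i × Blocks.size (2 * i) (1 + 2 * j) ≡ n

-- Writing n = r + 8q, b = 2j + 1 is the odd number nearest to n/4.
balancedBlocks : ∀ r q → r < 8 → r % 2 ≡ 1 → 9 ≤ r + q * 8 → BalancedBlocks (r + q * 8)
balancedBlocks 1 zero    _ _ (s≤s ())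
balancedBlocks 1 (suc k) _ _ _ = k , suc k , m≤n+m k 3 , ≤-refl , size≡ k
  where size≡ : ∀ k → 2 * k + ((1 + 2 * suc k) + ((1 + 2 * suc k) + (1 + 2 * suc k))) ≡ 1 + suc k * 8
        size≡ = solve-∀
balancedBlocks 3 q _ _ _ = q , q , m≤n+m q 2 , n≤1+n q , size≡ q
  where size≡ : ∀ q → 2 * q + ((1 + 2 * q) + ((1 + 2 * q) + (1 + 2 * q))) ≡ 3 + q * 8
        size≡ = solve-∀
balancedBlocks 5 q _ _ _ = suc q , q , s≤s (n≤1+n q) , m≤n+m q 2 , size≡ q
  where size≡ : ∀ q → 2 * suc q + ((1 + 2 * q) + ((1 + 2 * q) + (1 + 2 * q))) ≡ 5 + q * 8
        size≡ = solve-∀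
balancedBlocks 7 q _ _ _ = 2 + q , q , ≤-refl , m≤n+m q 3 , size≡ q
  where size≡ : ∀ q → 2 * (2 + q) + ((1 + 2 * q) + ((1 + 2 * q) + (1 + 2 * q))) ≡ 7 + q * 8
        size≡ = solve-∀
balancedBlocks 0 _ _ () _
balancedBlocks 2 _ _ () _
balancedBlocks 4 _ _ () _
balancedBlocks 6 _ _ () _
balancedBlocks (suc (suc (suc (suc (suc (suc (suc (suc r)))))))) _ r<8 _ _ = ⊥-elim (<⇒≱ r<8 (m≤m+n 8 r))

odd⇒balancedBlocks : ∀ n → 9 ≤ n → n % 2 ≡ 1 → BalancedBlocks n
odd⇒balancedBlocks n 9≤n odd = subst BalancedBlocks (sym n≡r+q*8)
  (balancedBlocks (n % 8) (n / 8) (m%n<n n 8) (trans (m∣n⇒o%n%m≡o%m 2 8 n (divides 4 refl)) odd)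
                  (subst (9 ≤_) n≡r+q*8 9≤n))
  where
  n≡r+q*8 : n ≡ n % 8 + n / 8 * 8
  n≡r+q*8 = m≡m%n+[m/n]*n n 8

proposition1p7 : ∃ λ N → (n : ℕ) → N ≤ n → (n % 6 ≡ 1 ⊎ n % 6 ≡ 3) →
    ∃ λ (H : Hypergraph3 n) →
      ((x y : _) → ¬ (x ≡ y) → 3 * n ≤ 4 * codegree H x y + 40) × ¬ ContainsSTS H
proposition1p7 = 9 , λ n 9≤n n%6∈1,3 → dense n (odd⇒balancedBlocks n 9≤n (odd n n%6∈1,3))
  where
  odd : ∀ n → n % 6 ≡ 1 ⊎ n % 6 ≡ 3 → n % 2 ≡ 1
  odd n n%6∈1,3 = trans (sym (m∣n⇒o%n%m≡o%m 2 6 n (divides 3 refl))) ([ cong (_% 2) , cong (_% 2) ]′ n%6∈1,3)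
  dense : ∀ n → BalancedBlocks n → DenseSTSFree n
  dense n (i , j , i≤2+j , j≤1+i , size≡n) = subst DenseSTSFree size≡n (EvenOddBlocks.denseSTSFree i j i≤2+j j≤1+i)
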